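{- Let $m\in\mathcal{M}_N$ have $k$ unstable chords. Then there exist indices $i_1,\dots,i_k$ such that $m=\mathrm{ins}_{i_1}\circ\cdots\circ\mathrm{ins}_{i_k}(\mathrm{core}(m))$.
   Context: A matching on a finite set $S\subseteq\mathbb{N}$ is a partition of $S$ into blocks of size 1 (unmatched vertex $(i)$) or 2 (chord $(i,j)$); $\mathcal{M}_N$ is the set of matchings on $[N]$. The reduction process of $m$ repeatedly deletes a chord whose two endpoints are consecutive among the currently remaining vertices, until none remains; deleted chords are unstable (independent of choices), and the remaining vertices relabeled $1,2,\dots$ in increasing order form $\mathrm{core}(m)$. For a matching $m'$ on $[M]$ and $1\le i\le M+1$, with $f_i(j)=j$ for $j<i$ and $f_i(j)=j+2$ for $j\ge i$, $\mathrm{ins}_i(m')$ is the matching on $[M+2]$ with chords $(f_i(j_1),f_i(j_2))$ for chords $(j_1,j_2)$ of $m'$, the chord $(i,i+1)$, and unmatched vertices $(f_i(j))$ for unmatched vertices $(j)$ of $m'$. -}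

module Defs where

open import Data.Nat using (ℕ; zero; suc; _+_; _∸_; _≤_; _<?_; _≟_)
open import Data.Fin using (Fin; toℕ)
open import Data.Vec using (Vec; lookup)
import Data.Vec as Vec
open import Data.List using (List; []; _∷_; _++_; map; take; drop; foldr; length; upTo)
open import Data.Maybe using (Maybe; just; nothing)
open import Data.Product using (_×_; _,_)
open import Data.Unit using (⊤)
open import Relation.Nullary using (yes; no)
open import Relation.Binary.PropositionalEquality using (_≡_)

-- Vertices of [N] are encoded 0-based as 0,…,N-1 (vertex j+1 of the paper is j here).
-- A matching on [N] is encoded by its partner involution: partner i = j iff (i,j)
-- is a chord, partner i = i iff (i) is an unmatched vertex.  Such involutions are in
-- bijection with partitions of [N] into blocks of size 1 or 2.
record Matching (N : ℕ) : Set where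
  field
    partner : Vec (Fin N) N
    invol   : ∀ i → lookup partner (lookup partner i) ≡ i
open Matching public

-- Raw encoding of a matching on [M]: a list of length M whose entry at (0-based)
-- position j is the (0-based) partner of j.
Raw : Set
Raw = List ℕ

toRaw : ∀ {N} → Matching N → Raw
toRaw m = Vec.toList (Vec.map toℕ (partner m))

partnerℕ : ∀ {N} → Matching N → ℕ → ℕ
partnerℕ {N} m a with a <? N
... | yes a<N = toℕ (lookup (partner m) (Data.Fin.fromℕ< a<N))
... | no _ = a

-- State: list of remaining (original, 0-based) vertices in
-- increasing order.  One step deletes the leftmost chord whose endpoints are
-- consecutive among the remaining vertices (the result is choice-independent).

module _ (p : ℕ → ℕ) where
  deleteFrom : ℕ → List ℕ → Maybe ((ℕ × ℕ) × List ℕ)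
  deleteFrom a [] = nothing
  deleteFrom a (b ∷ r) with p a ≟ b
  ... | yes _ = just ((a , b) , r)
  ... | no _ with deleteFrom b r
  ...   | nothing = nothing
  ...   | just (c , r') = just (c , a ∷ r')

  deleteStep : List ℕ → Maybe ((ℕ × ℕ) × List ℕ)
  deleteStep [] = nothing
  deleteStep (a ∷ r) = deleteFrom a r

  reduceWith : ℕ → List ℕ → List (ℕ × ℕ) × List ℕ
  reduceWith zero l = [] , l
  reduceWith (suc n) l with deleteStep l
  ... | nothing = [] , l
  ... | just (c , l') with reduceWith n l'
  ...   | (cs , r) = (c ∷ cs) , r

-- fuel N suffices: every step deletes two of the N vertices
reduction : ∀ {N} → Matching N → List (ℕ × ℕ) × List ℕ
reduction {N} m = reduceWith (partnerℕ m) N (upTo N)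

unstableChords : ∀ {N} → Matching N → List (ℕ × ℕ)
unstableChords m = Data.Product.proj₁ (reduction m)

remaining : ∀ {N} → Matching N → List ℕ
remaining m = Data.Product.proj₂ (reduction m)

-- 0-based position of x in a list (length of list if absent)
indexOf : ℕ → List ℕ → ℕ
indexOf x [] = 0
indexOf x (y ∷ ys) with x ≟ y
... | yes _ = 0
... | no _ = suc (indexOf x ys)

core : ∀ {N} → Matching N → Raw
core m = map (λ a → indexOf (partnerℕ m a) (remaining m)) (remaining m)

-- ins_i (paper's 1-based index i, 1 ≤ i ≤ M+1) on raw matchings on [M].
-- With c = i-1 the 0-based position, f_i becomes j ↦ j if j < c, j+2 otherwise;
-- the new chord (i,i+1) is the 0-based pair (c, c+1).
shiftFrom : ℕ → ℕ → ℕ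
shiftFrom c j with j <? c
... | yes _ = j
... | no _ = j + 2

ins : ℕ → Raw → Raw
ins i l = let c = i ∸ 1 in
  map (shiftFrom c) (take c l) ++ (suc c ∷ c ∷ []) ++ map (shiftFrom c) (drop c l)

insAll : List ℕ → Raw → Raw
insAll is base = foldr ins base is

ValidIns : List ℕ → Raw → Set
ValidIns [] base = ⊤
ValidIns (i ∷ is) base = (1 ≤ i) × (i ≤ suc (length (insAll is base))) × ValidIns is base

{-# OPTIONS --safe #-}
-- Relabel a list L of remaining vertices to positions 0,1,… and read off the induced matching.
-- If one reduction step deletes the chord (a, b), adjacent in L at position c, then every other
-- chord survives and only labels ≥ c move up by two, so relabel(L) = ins_{c+1}(relabel(L ∖ {a,b})).
-- The reduction starts from relabel([N]) = m and ends at core(m); reading its k steps backwards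
-- gives the k insertions.
module Submission where

open import Defs
open import Data.Nat using (ℕ; zero; suc; _≤_; _<_; _<?_; _≟_; z≤n; s≤s)
open import Data.Nat.Properties using (+-comm; suc-injective; ≤-trans; ≤-reflexive)
open import Data.Fin as Fin using (toℕ; fromℕ<)
open import Data.Fin.Properties using (toℕ<n; fromℕ<-toℕ; toℕ-fromℕ<)
open import Data.Vec using (Vec; lookup)
import Data.Vec as Vec
open import Data.Vec.Properties using (lookup-map)
open import Data.List using (List; []; _∷_; _++_; map; take; drop; length; upTo; applyUpTo)
open import Data.List.Properties
  using (map-++; map-∘; map-cong-local; map-upTo; length-map; length-++-≤ˡ; take-map; drop-map)
open import Data.List.Relation.Unary.All as All using (All; []; _∷_)
open import Data.List.Relation.Unary.All.Properties using (++⁺; ++⁻)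
open import Data.List.Relation.Unary.Unique.Propositional using (Unique; []; _∷_)
open import Data.List.Relation.Unary.Unique.Propositional.Properties using (upTo⁺)
open import Data.Product using (∃-syntax; _×_; _,_; proj₁; proj₂)
open import Data.Unit using (tt)
open import Data.Maybe using (just; nothing)
open import Data.Empty using (⊥-elim)
open import Relation.Nullary using (yes; no)
open import Relation.Binary.PropositionalEquality

shiftFrom-zero : ∀ j → shiftFrom 0 j ≡ suc (suc j)
shiftFrom-zero j = +-comm j 2

shiftFrom-suc-zero : ∀ c → shiftFrom (suc c) 0 ≡ 0
shiftFrom-suc-zero c with 0 <? suc c
... | yes _ = refl
... | no 0≮1+c = ⊥-elim (0≮1+c (s≤s z≤n))

shiftFrom-suc-suc : ∀ c j → shiftFrom (suc c) (suc j) ≡ suc (shiftFrom c j)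
shiftFrom-suc-suc c j with j <? c | suc j <? suc c
... | yes _   | yes _         = refl
... | no _    | no _          = refl
... | yes j<c | no 1+j≮1+c    = ⊥-elim (1+j≮1+c (s≤s j<c))
... | no j≮c  | yes (s≤s j<c) = ⊥-elim (j≮c j<c)

take-length-++ : ∀ {A : Set} (xs ys : List A) → take (length xs) (xs ++ ys) ≡ xs
take-length-++ []       ys = refl
take-length-++ (x ∷ xs) ys = cong (x ∷_) (take-length-++ xs ys)

drop-length-++ : ∀ {A : Set} (xs ys : List A) → drop (length xs) (xs ++ ys) ≡ ys
drop-length-++ []       ys = refl
drop-length-++ (x ∷ xs) ys = drop-length-++ xs ys

All-middle : ∀ {A : Set} {P : A → Set} pre {a b post} →
  All P (pre ++ a ∷ b ∷ post) → P a × P b × All P (pre ++ post)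
All-middle pre ps with ++⁻ pre ps
... | ps₁ , pa ∷ pb ∷ ps₂ = pa , pb , ++⁺ ps₁ ps₂

Unique-middle : ∀ {A : Set} pre {a b : A} {post} → Unique (pre ++ a ∷ b ∷ post) →
  a ≢ b × All (a ≢_) (pre ++ post) × All (b ≢_) (pre ++ post) × Unique (pre ++ post)
Unique-middle [] ((a≢b ∷ a∉) ∷ b∉ ∷ u) = a≢b , a∉ , b∉ , u
Unique-middle (x ∷ pre) (x∉ ∷ u) with Unique-middle pre u | All-middle pre x∉
... | a≢b , a∉ , b∉ , u′ | x≢a , x≢b , x∉′ = a≢b , ≢-sym x≢a ∷ a∉ , ≢-sym x≢b ∷ b∉ , x∉′ ∷ u′

indexOf-++-∷ : ∀ x pre {post} → All (x ≢_) pre → indexOf x (pre ++ x ∷ post) ≡ length pre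
indexOf-++-∷ x [] _ with x ≟ x
... | yes _   = refl
... | no x≢x = ⊥-elim (x≢x refl)
indexOf-++-∷ x (y ∷ pre) (x≢y ∷ x∉) with x ≟ y
... | yes x≡y = ⊥-elim (x≢y x≡y)
... | no _    = cong suc (indexOf-++-∷ x pre x∉)

indexOf-++-∷-∷ : ∀ b pre {a post} → All (b ≢_) pre → b ≢ a →
  indexOf b (pre ++ a ∷ b ∷ post) ≡ suc (length pre)
indexOf-++-∷-∷ b [] {a} _ b≢a with b ≟ a
... | yes b≡a = ⊥-elim (b≢a b≡a)
... | no _ with b ≟ b
...   | yes _   = refl
...   | no b≢b = ⊥-elim (b≢b refl)
indexOf-++-∷-∷ b (y ∷ pre) (b≢y ∷ b∉) b≢a with b ≟ y
... | yes b≡y = ⊥-elim (b≢y b≡y)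
... | no _    = cong suc (indexOf-++-∷-∷ b pre b∉ b≢a)

indexOf-insertPair : ∀ y pre {a b post} → y ≢ a → y ≢ b →
  indexOf y (pre ++ a ∷ b ∷ post) ≡ shiftFrom (length pre) (indexOf y (pre ++ post))
indexOf-insertPair y [] {a} {b} {post} y≢a y≢b with y ≟ a
... | yes y≡a = ⊥-elim (y≢a y≡a)
... | no _ with y ≟ b
...   | yes y≡b = ⊥-elim (y≢b y≡b)
...   | no _    = sym (shiftFrom-zero (indexOf y post))
indexOf-insertPair y (z ∷ pre) y≢a y≢b with y ≟ z
... | yes _ = sym (shiftFrom-suc-zero (length pre))
... | no _  = trans (cong suc (indexOf-insertPair y pre y≢a y≢b))
                    (sym (shiftFrom-suc-suc (length pre) _))

indexOf-map-injective : ∀ {f : ℕ → ℕ} → (∀ {x y} → f x ≡ f y → x ≡ y) →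
  ∀ x l → indexOf (f x) (map f l) ≡ indexOf x l
indexOf-map-injective f-inj x [] = refl
indexOf-map-injective {f} f-inj x (y ∷ l) with f x ≟ f y | x ≟ y
... | yes _     | yes _   = refl
... | no _      | no _    = cong suc (indexOf-map-injective f-inj x l)
... | yes fx≡fy | no x≢y  = ⊥-elim (x≢y (f-inj fx≡fy))
... | no fx≢fy  | yes x≡y = ⊥-elim (fx≢fy (cong f x≡y))

indexOf-upTo : ∀ {n x} → x < n → indexOf x (upTo n) ≡ x
indexOf-upTo {suc n} {zero}  _         = refl
indexOf-upTo {suc n} {suc x} (s≤s x<n) = cong suc (begin
  indexOf (suc x) (applyUpTo suc n)     ≡⟨ cong (indexOf (suc x)) (sym (map-upTo suc n)) ⟩
  indexOf (suc x) (map suc (upTo n))    ≡⟨ indexOf-map-injective suc-injective x (upTo n) ⟩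
  indexOf x (upTo n)                    ≡⟨ indexOf-upTo x<n ⟩
  x                                     ∎)
  where open ≡-Reasoning

map-upTo-toList : ∀ {n} (f : ℕ → ℕ) (w : Vec ℕ n) → (∀ i → f (toℕ i) ≡ lookup w i) →
  map f (upTo n) ≡ Vec.toList w
map-upTo-toList f Vec.[]       _  = refl
map-upTo-toList {suc n} f (x Vec.∷ w) eq = cong₂ _∷_ (eq Fin.zero) (begin
  map f (applyUpTo suc n)     ≡⟨ cong (map f) (sym (map-upTo suc n)) ⟩
  map f (map suc (upTo n))    ≡⟨ sym (map-∘ (upTo n)) ⟩
  map (λ j → f (suc j)) (upTo n) ≡⟨ map-upTo-toList (λ j → f (suc j)) w (λ i → eq (Fin.suc i)) ⟩
  Vec.toList w                ∎)
  where open ≡-Reasoning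

partnerℕ-toℕ : ∀ {N} (m : Matching N) i → partnerℕ m (toℕ i) ≡ toℕ (lookup (partner m) i)
partnerℕ-toℕ {N} m i with toℕ i <? N
... | yes i<N = cong (λ j → toℕ (lookup (partner m) j)) (fromℕ<-toℕ i i<N)
... | no i≮N  = ⊥-elim (i≮N (toℕ<n i))

partnerℕ-involutive : ∀ {N} (m : Matching N) x → partnerℕ m (partnerℕ m x) ≡ x
partnerℕ-involutive {N} m x with x <? N
... | yes x<N = begin
  partnerℕ m (toℕ (lookup (partner m) (fromℕ< x<N)))   ≡⟨ partnerℕ-toℕ m _ ⟩
  toℕ (lookup (partner m) (lookup (partner m) (fromℕ< x<N))) ≡⟨ cong toℕ (invol m _) ⟩
  toℕ (fromℕ< x<N)                                      ≡⟨ toℕ-fromℕ< x<N ⟩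
  x                                                     ∎
  where open ≡-Reasoning
... | no x≮N with x <? N
...   | yes x<N = ⊥-elim (x≮N x<N)
...   | no _    = refl

relabel : (ℕ → ℕ) → List ℕ → Raw
relabel p L = map (λ x → indexOf (p x) L) L

relabel-upTo : ∀ {N} (m : Matching N) → relabel (partnerℕ m) (upTo N) ≡ toRaw m
relabel-upTo {N} m = map-upTo-toList _ (Vec.map toℕ (partner m)) λ i → begin
  indexOf (partnerℕ m (toℕ i)) (upTo N)          ≡⟨ cong (λ z → indexOf z (upTo N)) (partnerℕ-toℕ m i) ⟩
  indexOf (toℕ (lookup (partner m) i)) (upTo N) ≡⟨ indexOf-upTo (toℕ<n _) ⟩
  toℕ (lookup (partner m) i)                    ≡⟨ sym (lookup-map i toℕ (partner m)) ⟩
  lookup (Vec.map toℕ (partner m)) i            ∎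
  where open ≡-Reasoning

BuiltBy : ℕ → Raw → Raw → Set
BuiltBy k base target = ∃[ is ] (length is ≡ k × ValidIns is base × target ≡ insAll is base)

BuiltBy-zero : ∀ base → BuiltBy 0 base base
BuiltBy-zero base = [] , refl , tt , refl

BuiltBy-ins : ∀ {k base target} c → c ≤ length target →
  BuiltBy k base target → BuiltBy (suc k) base (ins (suc c) target)
BuiltBy-ins c c≤len (is , refl , valid , refl) = suc c ∷ is , refl , (s≤s z≤n , s≤s c≤len , valid) , refl

module Reduction (p : ℕ → ℕ) (p-involutive : ∀ x → p (p x) ≡ x) where

  deleteFrom-split : ∀ x r {a b L′} → deleteFrom p x r ≡ just ((a , b) , L′) →
    ∃[ pre ] ∃[ post ] (x ∷ r ≡ pre ++ a ∷ b ∷ post × L′ ≡ pre ++ post × p a ≡ b)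
  deleteFrom-split x [] ()
  deleteFrom-split x (y ∷ r) eq with p x ≟ y
  deleteFrom-split x (y ∷ r) refl | yes px≡y = [] , r , refl , refl , px≡y
  ... | no _ with deleteFrom p y r in eq′
  deleteFrom-split x (y ∷ r) ()   | no _ | nothing
  deleteFrom-split x (y ∷ r) refl | no _ | just _ with deleteFrom-split y r eq′
  ... | pre , post , r≡ , L′≡ , pa≡b = x ∷ pre , post , cong (x ∷_) r≡ , cong (x ∷_) L′≡ , pa≡b

  deleteStep-split : ∀ L {a b L′} → deleteStep p L ≡ just ((a , b) , L′) →
    ∃[ pre ] ∃[ post ] (L ≡ pre ++ a ∷ b ∷ post × L′ ≡ pre ++ post × p a ≡ b)
  deleteStep-split []      ()
  deleteStep-split (x ∷ r) eq = deleteFrom-split x r eq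

  relabel-deletePair : ∀ pre {a b post} → p a ≡ b → Unique (pre ++ a ∷ b ∷ post) →
    relabel p (pre ++ a ∷ b ∷ post) ≡ ins (suc (length pre)) (relabel p (pre ++ post))
  relabel-deletePair pre {a} {b} {post} pa≡b u with Unique-middle pre u
  ... | a≢b , a∉ , b∉ , _ = begin
    map g (pre ++ a ∷ b ∷ post)
      ≡⟨ map-++ g pre (a ∷ b ∷ post) ⟩
    map g pre ++ g a ∷ g b ∷ map g post
      ≡⟨ cong₂ (λ u v → map g pre ++ u ∷ v ∷ map g post) ga gb ⟩
    map g pre ++ suc c ∷ c ∷ map g post
      ≡⟨ cong₂ (λ u v → u ++ suc c ∷ c ∷ v) (shifted pre g-shift-pre) (shifted post g-shift-post) ⟩
    map sh (map g′ pre) ++ suc c ∷ c ∷ map sh (map g′ post)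
      ≡⟨ cong₂ (λ u v → map sh u ++ suc c ∷ c ∷ map sh v) (sym take-relabel) (sym drop-relabel) ⟩
    ins (suc c) (relabel p (pre ++ post)) ∎
    where
    open ≡-Reasoning
    c = length pre
    sh = shiftFrom c
    g g′ : ℕ → ℕ
    g x = indexOf (p x) (pre ++ a ∷ b ∷ post)
    g′ x = indexOf (p x) (pre ++ post)

    pb≡a : p b ≡ a
    pb≡a = trans (cong p (sym pa≡b)) (p-involutive a)

    ga : g a ≡ suc c
    ga = trans (cong (λ z → indexOf z (pre ++ a ∷ b ∷ post)) pa≡b)
               (indexOf-++-∷-∷ b pre (proj₁ (++⁻ pre b∉)) (≢-sym a≢b))

    gb : g b ≡ c
    gb = trans (cong (λ z → indexOf z (pre ++ a ∷ b ∷ post)) pb≡a)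
               (indexOf-++-∷ a pre (proj₁ (++⁻ pre a∉)))

    g-shift : ∀ {x} → a ≢ x → b ≢ x → g x ≡ sh (g′ x)
    g-shift {x} a≢x b≢x = indexOf-insertPair (p x) pre
      (λ px≡a → b≢x (trans (sym (trans (cong p px≡a) pa≡b)) (p-involutive x)))
      (λ px≡b → a≢x (trans (sym (trans (cong p px≡b) pb≡a)) (p-involutive x)))

    g-shift-all : All (λ x → g x ≡ sh (g′ x)) (pre ++ post)
    g-shift-all = All.zipWith (λ (a≢x , b≢x) → g-shift a≢x b≢x) (a∉ , b∉)

    g-shift-pre = proj₁ (++⁻ pre g-shift-all)
    g-shift-post = proj₂ (++⁻ pre g-shift-all)

    shifted : ∀ xs → All (λ x → g x ≡ sh (g′ x)) xs → map g xs ≡ map sh (map g′ xs)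
    shifted xs eqs = trans (map-cong-local eqs) (map-∘ xs)

    take-relabel : take c (relabel p (pre ++ post)) ≡ map g′ pre
    take-relabel = trans (take-map c (pre ++ post)) (cong (map g′) (take-length-++ pre post))

    drop-relabel : drop c (relabel p (pre ++ post)) ≡ map g′ post
    drop-relabel = trans (drop-map c (pre ++ post)) (cong (map g′) (drop-length-++ pre post))

  relabel-deleteStep : ∀ {L a b L′} → Unique L → deleteStep p L ≡ just ((a , b) , L′) →
    Unique L′ × ∃[ c ] (c ≤ length (relabel p L′) × relabel p L ≡ ins (suc c) (relabel p L′))
  relabel-deleteStep {L} u eq with deleteStep-split L eq
  ... | pre , post , refl , refl , pa≡b =
    proj₂ (proj₂ (proj₂ (Unique-middle pre u))) ,
    length pre ,
    ≤-trans (length-++-≤ˡ pre) (≤-reflexive (sym (length-map _ (pre ++ post)))) ,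
    relabel-deletePair pre pa≡b u

  reduceWith-builds : ∀ n L → Unique L →
    BuiltBy (length (proj₁ (reduceWith p n L))) (relabel p (proj₂ (reduceWith p n L))) (relabel p L)
  reduceWith-builds zero L _ = BuiltBy-zero (relabel p L)
  reduceWith-builds (suc n) L u with deleteStep p L in eq
  ... | nothing = BuiltBy-zero (relabel p L)
  ... | just ((a , b) , L′) with relabel-deleteStep u eq
  ...   | u′ , c , c≤len , relabel-L =
    subst (BuiltBy _ _) (sym relabel-L) (BuiltBy-ins c c≤len (reduceWith-builds n L′ u′))

lemma5p9 : ∀ (N : ℕ) (m : Matching N) (k : ℕ) → length (unstableChords m) ≡ k →
    ∃[ is ] (length is ≡ k × ValidIns is (core m) × toRaw m ≡ insAll is (core m))
lemma5p9 N m k refl =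
  subst (BuiltBy _ (core m)) (relabel-upTo m) (reduceWith-builds N (upTo N) (upTo⁺ N))
  where open Reduction (partnerℕ m) (partnerℕ-involutive m)
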